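{- The emptiness problem for multicounter automata (deciding whether a given MCA has an accepting run) is computably many-one reducible to the finite satisfiability problem for $\mathrm{C}^2(*,1,\{<\})$; i.e. the latter problem is at least as hard as the former.
   Context: A multicounter automaton (MCA) is a tuple $\langle Q,C,R,\delta,q_I,F\rangle$ with finite state set $Q$, initial state $q_I$, final states $F\subseteq Q$, finite set of counters $C$, $R\subseteq C$, and $\delta\subseteq Q\times\{inc(c),dec(c),skip: c\in C\}\times Q$. Configurations are pairs $\langle p,\vec n\rangle$, $\vec n\in\mathbb{N}^C$; $inc(c)$ increments counter $c$, $dec(c)$ is applicable only when counter $c$ is positive and decrements it, skip changes no counter; the state changes from $p$ to $q$. An accepting run starts at $\langle q_I,\vec 0\rangle$ and ends in $\langle q_F,\vec n_F\rangle$ with $q_F\in F$ and $\vec n_F(c)=0$ for $c\in R$. $\mathrm{C}^2$ is the two-variable fragment of first-order logic with counting quantifiers $\exists^{<k},\exists^{\le k},\exists^{=k},\exists^{\ge k},\exists^{>k}$. $\mathrm{C}^2(*,1,\{<\})$ denotes $\mathrm{C}^2$ sentences over a relational signature with arbitrarily many unary predicates, at most one binary predicate besides the distinguished symbol $<$, where $<$ is interpreted as a strict linear order; finite satisfiability asks for a finite model. -}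

module Defs where

open import Data.Nat using (ℕ; zero; suc; _<?_; _≤?_; _≟_)
open import Data.Bool using (Bool; true; false; not; _∧_; _∨_; if_then_else_)
import Data.Fin as Fin
open import Data.Fin using (Fin) renaming (_≟_ to _≟ᶠ_)
open import Data.Vec using (Vec; lookup; replicate; _[_]%=_; _[_]≔_)
open import Data.List using (List; allFin; filter; length)
open import Data.List.Membership.Propositional using (_∈_)
open import Data.Product using (Σ; _×_; _,_; ∃)
open import Data.Sum using (_⊎_)
open import Relation.Nullary using (¬_; does)
open import Relation.Binary.PropositionalEquality using (_≡_; _≢_)
open import Relation.Binary.Construct.Closure.ReflexiveTransitive using (Star)

data Op (nC : ℕ) : Set where
  inc  : Fin nC → Op nC
  dec  : Fin nC → Op nC
  skip : Op nC

-- An MCA ⟨Q, C, R, δ, q_I, F⟩ with Q = Fin nQ and C = Fin nC;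
-- subsets R ⊆ C and F ⊆ Q are given by characteristic functions.
record MCA : Set where
  field
    nQ : ℕ
    nC : ℕ
    R  : Fin nC → Bool
    δ  : List (Fin nQ × Op nC × Fin nQ)
    qI : Fin nQ
    F  : Fin nQ → Bool

module _ (M : MCA) where
  open MCA M

  Config : Set
  Config = Fin nQ × Vec ℕ nC

  data Step : Config → Config → Set where
    inc-step  : ∀ {p q c v} → (p , inc c , q) ∈ δ →
                Step (p , v) (q , v [ c ]%= suc)
    dec-step  : ∀ {p q c v m} → (p , dec c , q) ∈ δ → lookup v c ≡ suc m →
                Step (p , v) (q , v [ c ]≔ m)
    skip-step : ∀ {p q v} → (p , skip , q) ∈ δ →
                Step (p , v) (q , v)

  HasAcceptingRun : Set
  HasAcceptingRun =
    Σ (Fin nQ) λ qF → Σ (Vec ℕ nC) λ nF →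
      Star Step (qI , replicate nC 0) (qF , nF) ×
      F qF ≡ true ×
      (∀ c → R c ≡ true → lookup nF c ≡ 0)

-- C²(*,1,{<}): two variables, u unary predicates, one binary predicate B,
-- and the distinguished symbol <.

Var : Set
Var = Fin 2

data Cmp : Set where
  lt le eq ge gt : Cmp

data Formula (u : ℕ) : Set where
  pred   : Fin u → Var → Formula u
  bin    : Var → Var → Formula u
  less   : Var → Var → Formula u
  equal  : Var → Var → Formula u
  ¬ᶠ_    : Formula u → Formula u
  _∧ᶠ_   : Formula u → Formula u → Formula u
  _∨ᶠ_   : Formula u → Formula u → Formula u
  -- count ⋈ k v φ  is  ∃^{⋈k} v. φ
  count  : Cmp → ℕ → Var → Formula u → Formula u

free : ∀ {u} → Var → Formula u → Bool
free x (pred _ v)      = does (x ≟ᶠ v)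
free x (bin v w)       = does (x ≟ᶠ v) ∨ does (x ≟ᶠ w)
free x (less v w)      = does (x ≟ᶠ v) ∨ does (x ≟ᶠ w)
free x (equal v w)     = does (x ≟ᶠ v) ∨ does (x ≟ᶠ w)
free x (¬ᶠ φ)          = free x φ
free x (φ ∧ᶠ ψ)        = free x φ ∨ free x ψ
free x (φ ∨ᶠ ψ)        = free x φ ∨ free x ψ
free x (count _ _ v φ) = not (does (x ≟ᶠ v)) ∧ free x φ

Closed : ∀ {u} → Formula u → Set
Closed φ = ∀ x → free x φ ≡ false

record Sentence : Set where
  constructor sentence
  field
    u       : ℕ
    φ       : Formula u
    closed  : Closed φ

record Structure (u : ℕ) : Set where
  field
    n  : ℕ
    P  : Fin u → Fin (suc n) → Bool
    B  : Fin (suc n) → Fin (suc n) → Bool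
    Lt : Fin (suc n) → Fin (suc n) → Bool

IsStrictLinearOrder : ∀ {m} → (Fin m → Fin m → Bool) → Set
IsStrictLinearOrder {m} r =
  (∀ x → r x x ≡ false) ×
  (∀ x y z → r x y ≡ true → r y z ≡ true → r x z ≡ true) ×
  (∀ x y → x ≢ y → r x y ≡ true ⊎ r y x ≡ true)

cmp : Cmp → ℕ → ℕ → Bool
cmp lt c k = does (c <? k)
cmp le c k = does (c ≤? k)
cmp eq c k = does (c ≟ k)
cmp ge c k = does (k ≤? c)
cmp gt c k = does (k <? c)

module _ {u : ℕ} (𝔄 : Structure u) where
  open Structure 𝔄

  D : Set
  D = Fin (suc n)

  update : (Var → D) → Var → D → (Var → D)
  update ρ v d x = if does (x ≟ᶠ v) then d else ρ x

  eval : Formula u → (Var → D) → Bool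
  eval (pred i v)      ρ = P i (ρ v)
  eval (bin v w)       ρ = B (ρ v) (ρ w)
  eval (less v w)      ρ = Lt (ρ v) (ρ w)
  eval (equal v w)     ρ = does (ρ v ≟ᶠ ρ w)
  eval (¬ᶠ φ)          ρ = not (eval φ ρ)
  eval (φ ∧ᶠ ψ)        ρ = eval φ ρ ∧ eval ψ ρ
  eval (φ ∨ᶠ ψ)        ρ = eval φ ρ ∨ eval ψ ρ
  eval (count c k v φ) ρ =
    cmp c (length (filter (λ d → eval φ (update ρ v d) Data.Bool.≟ true) (allFin (suc n)))) k


FinSat : Sentence → Set
FinSat (sentence u φ _) =
  Σ (Structure u) λ 𝔄 →
    IsStrictLinearOrder (Structure.Lt 𝔄) ×
    eval 𝔄 φ (λ _ → Fin.zero) ≡ true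

module Submission where

-- The unary predicates of the sentence Φ M are labels: 0 for
-- a virtual start transition (qI, skip, qI), suc t for the t-th transition
-- of δ.  A model of Φ M is a run laid out along the order <: B links each
-- element to its successor (x < y ∧ B x y) and each increment to the later
-- decrement of the same counter consuming it (x < y ∧ B y x).  The axioms
-- say that successor links form a chain of consecutive transitions from the
-- unique start element to a final state, that every decrement consumes
-- exactly one earlier increment, and that increments of counters in R are
-- consumed.
--
-- Soundness turns a model into a run whose counters at w
-- are the increments up to w not consumed up to w; completeness turns a
-- run into a model on its positions, matching the k-th increment of a
-- counter with its k-th decrement.

open import Defs
open import Data.Nat using (ℕ; zero; suc; _+_; _≤_; _<_; z≤n; s≤s; s≤s⁻¹; _<?_; _≤?_)
import Data.Nat as ℕ
open import Data.Nat.Properties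
open import Data.Nat.Induction using (<-wellFounded)
open import Data.Bool using (Bool; true; false; not; _∧_; _∨_; if_then_else_)
open import Data.Bool.Properties using (∧-zeroʳ; ∧-identityʳ)
import Data.Bool as Bool
open import Data.Fin using (Fin; toℕ; fromℕ<) renaming (_≟_ to _≟ᶠ_)
import Data.Fin as Fin
import Data.Fin.Properties as Finₚ
open import Data.Vec using (Vec; lookup; tabulate; replicate; _[_]%=_; _[_]≔_)
open import Data.Vec.Properties
  using (lookup∘tabulate; lookup-replicate; lookup∘updateAt; lookup∘updateAt′; tabulate∘lookup; tabulate-cong)
open import Data.List using (List; []; _∷_; length; filter; allFin)
import Data.List as List
open import Data.List.Membership.Propositional using (_∈_)
open import Data.List.Membership.Propositional.Properties using (∈-allFin; ∈-lookup)
open import Data.List.Relation.Unary.Any using (here; there; index)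
open import Data.List.Relation.Unary.Any.Properties using (lookup-index)
open import Algebra.Properties.CommutativeSemigroup +-commutativeSemigroup using (x∙yz≈y∙xz)
import Data.List.Relation.Unary.All as All
open import Data.List.Relation.Unary.AllPairs using ([]; _∷_)
open import Data.List.Relation.Unary.Unique.Propositional using (Unique)
open import Data.List.Relation.Unary.Unique.Propositional.Properties using (allFin⁺)
open import Data.Product using (Σ; _×_; _,_; proj₁; proj₂)
open import Data.Sum using (_⊎_; inj₁; inj₂; [_,_]′)
import Data.Sum
open import Data.Empty using (⊥; ⊥-elim)
open import Function using (_∘_)
open import Induction.WellFounded using (WellFounded)
import Induction.WellFounded as WF
import Relation.Binary.Construct.On as On
open import Relation.Binary.Definitions using (tri<; tri≈; tri>)
open import Relation.Nullary using (Dec; does; yes; no)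
open import Relation.Nullary.Decidable using (dec-true; dec-false)
open import Relation.Binary.PropositionalEquality
open import Relation.Binary.Construct.Closure.ReflexiveTransitive using (Star; ε; _◅_; _◅◅_)

∧-elimˡ : ∀ {a b} → a ∧ b ≡ true → a ≡ true
∧-elimˡ {true} _ = refl

∧-elimʳ : ∀ {a b} → a ∧ b ≡ true → b ≡ true
∧-elimʳ {true} e = e

∧-intro : ∀ {a b} → a ≡ true → b ≡ true → a ∧ b ≡ true
∧-intro refl refl = refl

∨-elim : ∀ {a b} → a ∨ b ≡ true → a ≡ true ⊎ b ≡ true
∨-elim {true} _ = inj₁ refl
∨-elim {false} e = inj₂ e

∨-introˡ : ∀ {a b} → a ≡ true → a ∨ b ≡ true
∨-introˡ refl = refl

∨-introʳ : ∀ {a b} → b ≡ true → a ∨ b ≡ true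
∨-introʳ {true} _ = refl
∨-introʳ {false} e = e

not≡true : ∀ {a} → not a ≡ true → a ≡ false
not≡true {false} _ = refl

not≡false : ∀ {a} → not a ≡ false → a ≡ true
not≡false {true} _ = refl

not-false : ∀ {a} → a ≡ false → not a ≡ true
not-false refl = refl

true≢false : ∀ {a} → a ≡ true → a ≡ false → ⊥
true≢false refl ()

bool-ext : ∀ {a b} → (a ≡ true → b ≡ true) → (b ≡ true → a ≡ true) → a ≡ b
bool-ext {true} f _ = sym (f refl)
bool-ext {false} {true} _ g = g refl
bool-ext {false} {false} _ _ = refl

false-or-true : ∀ (a : Bool) → a ≡ false ⊎ a ≡ true
false-or-true false = inj₁ refl
false-or-true true = inj₂ refl

does-true : ∀ {p} {P : Set p} (d : Dec P) → does d ≡ true → P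
does-true (yes p) _ = p

≟-refl : ∀ {k} (a : Fin k) → does (a ≟ᶠ a) ≡ true
≟-refl a = dec-true (a ≟ᶠ a) refl

⟦_⟧ : Bool → ℕ
⟦ true ⟧ = 1
⟦ false ⟧ = 0

vec-ext : ∀ {A : Set} {k} {u v : Vec A k} → (∀ i → lookup u i ≡ lookup v i) → u ≡ v
vec-ext {u = u} {v} h = trans (sym (tabulate∘lookup u)) (trans (tabulate-cong h) (tabulate∘lookup v))

m+0≡n+0⇒m≡n : ∀ {m n} → m + 0 ≡ n + 0 → m ≡ n
m+0≡n+0⇒m≡n {m} {n} e = trans (sym (+-identityʳ m)) (trans e (+-identityʳ n))

m+0≡n+1⇒m≡1+n : ∀ {m n} → m + 0 ≡ n + 1 → m ≡ suc n
m+0≡n+1⇒m≡1+n {m} {n} e = trans (sym (+-identityʳ m)) (trans e (+-comm n 1))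

module Counting {A : Set} where

  tally : (A → Bool) → List A → ℕ
  tally f [] = 0
  tally f (x ∷ xs) = if f x then suc (tally f xs) else tally f xs

  length-filter : ∀ f xs → length (filter (λ x → f x Bool.≟ true) xs) ≡ tally f xs
  length-filter f [] = refl
  length-filter f (x ∷ xs) with f x
  ... | true = cong suc (length-filter f xs)
  ... | false = length-filter f xs

  tally-cong : ∀ f g xs → (∀ x → x ∈ xs → f x ≡ g x) → tally f xs ≡ tally g xs
  tally-cong f g [] h = refl
  tally-cong f g (x ∷ xs) h rewrite h x (here refl) =
    cong (λ k → if g x then suc k else k) (tally-cong f g xs (λ y y∈ → h y (there y∈)))

  tally-zero : ∀ f xs → (∀ x → x ∈ xs → f x ≡ false) → tally f xs ≡ 0
  tally-zero f [] h = refl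
  tally-zero f (x ∷ xs) h rewrite h x (here refl) = tally-zero f xs (λ y y∈ → h y (there y∈))

  tally-pos : ∀ f xs → 1 ≤ tally f xs → Σ A λ x → f x ≡ true
  tally-pos f (y ∷ xs) p with f y in eq
  ... | true = y , eq
  ... | false = tally-pos f xs p

  tally-pos⁻ : ∀ f xs x → x ∈ xs → f x ≡ true → 1 ≤ tally f xs
  tally-pos⁻ f (y ∷ xs) x x∈ fx with f y in eq
  ... | true = s≤s z≤n
  tally-pos⁻ f (y ∷ xs) x (here refl) fx | false = ⊥-elim (true≢false fx eq)
  tally-pos⁻ f (y ∷ xs) x (there x∈) fx | false = tally-pos⁻ f xs x x∈ fx

  tally-zero⁻ : ∀ f xs → tally f xs ≡ 0 → ∀ x → x ∈ xs → f x ≡ false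
  tally-zero⁻ f xs e x x∈ with f x in fx
  ... | false = refl
  ... | true with () ← subst (1 ≤_) e (tally-pos⁻ f xs x x∈ fx)

  tally-≤1 : ∀ f xs → tally f xs ≤ 1 →
             ∀ x y → x ∈ xs → y ∈ xs → f x ≡ true → f y ≡ true → x ≡ y
  tally-≤1 f (z ∷ xs) p x y x∈ y∈ fx fy with f z in eq
  tally-≤1 f (z ∷ xs) p x y (here refl) (here refl) fx fy | true = refl
  tally-≤1 f (z ∷ xs) (s≤s p) x y (here refl) (there y∈) fx fy | true
    with () ← ≤-trans (tally-pos⁻ f xs y y∈ fy) p
  tally-≤1 f (z ∷ xs) (s≤s p) x y (there x∈) _ fx fy | true
    with () ← ≤-trans (tally-pos⁻ f xs x x∈ fx) p
  tally-≤1 f (z ∷ xs) p x y (here refl) y∈ fx fy | false = ⊥-elim (true≢false fx eq)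
  tally-≤1 f (z ∷ xs) p x y (there x∈) (here refl) fx fy | false = ⊥-elim (true≢false fy eq)
  tally-≤1 f (z ∷ xs) p x y (there x∈) (there y∈) fx fy | false = tally-≤1 f xs p x y x∈ y∈ fx fy

  tally-≤1⁻ : ∀ f xs → Unique xs → (∀ x y → f x ≡ true → f y ≡ true → x ≡ y) → tally f xs ≤ 1
  tally-≤1⁻ f [] u h = z≤n
  tally-≤1⁻ f (z ∷ xs) (z∉ ∷ u) h with f z in fz
  ... | true = s≤s (≤-reflexive (tally-zero f xs others))
    where others : ∀ x → x ∈ xs → f x ≡ false
          others x x∈ with f x in fx
          ... | false = refl
          ... | true = ⊥-elim (All.lookup z∉ x∈ (h z x fz fx))
  ... | false = tally-≤1⁻ f xs u h

  tally-insert : ∀ f g xs → Unique xs → ∀ a → a ∈ xs → f a ≡ false →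
                 (∀ x → x ≢ a → f x ≡ g x) → tally g xs ≡ ⟦ g a ⟧ + tally f xs
  tally-insert f g (z ∷ xs) (z∉ ∷ u) a (here refl) fa h rewrite fa
    with g z | tally-cong g f xs (λ x x∈ → sym (h x (λ e → All.lookup z∉ x∈ (sym e))))
  ... | true | same = cong suc same
  ... | false | same = same
  tally-insert f g (z ∷ xs) (z∉ ∷ u) a (there a∈) fa h rewrite h z (λ e → All.lookup z∉ a∈ e) with g z
  ... | true = trans (cong suc (tally-insert f g xs u a a∈ fa h)) (sym (+-suc ⟦ g a ⟧ (tally f xs)))
  ... | false = tally-insert f g xs u a a∈ fa h

  tally-mono : ∀ f g xs → (∀ x → f x ≡ true → g x ≡ true) → tally f xs ≤ tally g xs
  tally-mono f g [] h = z≤n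
  tally-mono f g (z ∷ xs) h with f z in fz | g z in gz
  ... | true | true = s≤s (tally-mono f g xs h)
  ... | true | false = ⊥-elim (true≢false (h z fz) gz)
  ... | false | true = m≤n⇒m≤1+n (tally-mono f g xs h)
  ... | false | false = tally-mono f g xs h

  tally-strict : ∀ f g xs → (∀ x → f x ≡ true → g x ≡ true) →
                 ∀ a → a ∈ xs → f a ≡ false → g a ≡ true → tally f xs < tally g xs
  tally-strict f g (z ∷ xs) h a (here refl) fa ga rewrite fa | ga = s≤s (tally-mono f g xs h)
  tally-strict f g (z ∷ xs) h a (there a∈) fa ga with f z in fz | g z in gz
  ... | true | true = s≤s (tally-strict f g xs h a a∈ fa ga)
  ... | true | false = ⊥-elim (true≢false (h z fz) gz)
  ... | false | true = m≤n⇒m≤1+n (tally-strict f g xs h a a∈ fa ga)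
  ... | false | false = tally-strict f g xs h a a∈ fa ga

open Counting

module StrictLinearOrder {k : ℕ} (_≺_ : Fin k → Fin k → Bool) (slo : IsStrictLinearOrder _≺_) where

  ≺-irrefl : ∀ a → a ≺ a ≡ false
  ≺-irrefl = proj₁ slo

  ≺-trans : ∀ a b c → a ≺ b ≡ true → b ≺ c ≡ true → a ≺ c ≡ true
  ≺-trans = proj₁ (proj₂ slo)

  ≺⇒≢ : ∀ {a b} → a ≺ b ≡ true → a ≢ b
  ≺⇒≢ {a} l refl = true≢false l (≺-irrefl a)

  compare : ∀ a b → a ≡ b ⊎ a ≺ b ≡ true ⊎ b ≺ a ≡ true
  compare a b with a ≟ᶠ b
  ... | yes a≡b = inj₁ a≡b
  ... | no a≢b = inj₂ (proj₂ (proj₂ slo) a b a≢b)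

  _≼_ : Fin k → Fin k → Bool
  a ≼ b = a ≺ b ∨ does (a ≟ᶠ b)

  ≼-refl : ∀ a → a ≼ a ≡ true
  ≼-refl a = ∨-introʳ {a ≺ a} (≟-refl a)

  ≺⇒≼ : ∀ {a b} → a ≺ b ≡ true → a ≼ b ≡ true
  ≺⇒≼ = ∨-introˡ

  ≡⇒≼ : ∀ {a b} → a ≡ b → a ≼ b ≡ true
  ≡⇒≼ {a} refl = ≼-refl a

  ≼⇒ : ∀ {a b} → a ≼ b ≡ true → a ≺ b ≡ true ⊎ a ≡ b
  ≼⇒ {a} {b} e = Data.Sum.map₂ (does-true (a ≟ᶠ b)) (∨-elim e)

  ≼-≺-trans : ∀ {a b c} → a ≼ b ≡ true → b ≺ c ≡ true → a ≺ c ≡ true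
  ≼-≺-trans {a} {b} {c} e l = [ (λ l′ → ≺-trans a b c l′ l) , (λ { refl → l }) ]′ (≼⇒ e)

  ≺⇒¬≽ : ∀ {a b} → a ≺ b ≡ true → b ≼ a ≡ false
  ≺⇒¬≽ {a} {b} l with b ≼ a in e
  ... | false = refl
  ... | true = ⊥-elim (true≢false (≼-≺-trans e l) (≺-irrefl b))

  -- The rank of a (the number of elements below it) increases along ≺,
  -- so ≺ is well founded.
  rank : Fin k → ℕ
  rank a = tally (λ b → b ≺ a) (allFin k)

  rank-mono : ∀ {a b} → a ≺ b ≡ true → rank a < rank b
  rank-mono {a} {b} l = tally-strict (λ y → y ≺ a) (λ y → y ≺ b) (allFin k)
    (λ y l′ → ≺-trans y a b l′ l) a (∈-allFin a) (≺-irrefl a) l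

  induction : (Q : Fin k → Set) → (∀ a → (∀ b → b ≺ a ≡ true → Q b) → Q a) → ∀ a → Q a
  induction Q step = WF.All.wfRec ≺-wellFounded _ Q (λ a ih → step a (λ b l → ih l))
    where ≺-wellFounded : WellFounded (λ b a → b ≺ a ≡ true)
          ≺-wellFounded = WF.Subrelation.wellFounded rank-mono (On.wellFounded rank <-wellFounded)

  maximum : Fin k → Σ (Fin k) λ m → ∀ b → b ≼ m ≡ true
  maximum a = let (m , m-max) = maximumOf a (allFin k) in m , λ b → m-max b (there (∈-allFin b))
    where
    maximumOf : ∀ a xs → Σ (Fin k) λ m → ∀ b → b ∈ (a ∷ xs) → b ≼ m ≡ true
    maximumOf a [] = a , λ { b (here refl) → ≼-refl a }
    maximumOf a (x ∷ xs) with maximumOf x xs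
    ... | m , m-max with compare a m
    ... | inj₁ refl = m , λ { b (here refl) → ≼-refl m ; b (there b∈) → m-max b b∈ }
    ... | inj₂ (inj₁ a<m) = m , λ { b (here refl) → ≺⇒≼ a<m ; b (there b∈) → m-max b b∈ }
    ... | inj₂ (inj₂ m<a) = a , λ { b (here refl) → ≼-refl a
                                  ; b (there b∈) → ≺⇒≼ (≼-≺-trans (m-max b b∈) m<a) }

fin-order : ∀ {k} → IsStrictLinearOrder {k} (λ a b → does (toℕ a <? toℕ b))
fin-order = (λ a → dec-false (toℕ a <? toℕ a) (<-irrefl refl))
          , (λ a b c l l′ → dec-true (toℕ a <? toℕ c)
                               (<-trans (does-true (toℕ a <? toℕ b) l) (does-true (toℕ b <? toℕ c) l′)))
          , connex
  where
  connex : ∀ a b → a ≢ b → does (toℕ a <? toℕ b) ≡ true ⊎ does (toℕ b <? toℕ a) ≡ true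
  connex a b a≢b with <-cmp (toℕ a) (toℕ b)
  ... | tri< a<b _ _ = inj₁ (dec-true (toℕ a <? toℕ b) a<b)
  ... | tri≈ _ a≡b _ = ⊥-elim (a≢b (Finₚ.toℕ-injective a≡b))
  ... | tri> _ _ b<a = inj₂ (dec-true (toℕ b <? toℕ a) b<a)

-- Prefix counts: how often a test holds at the positions 1, 2, ..., j.

module PrefixCount (h : ℕ → Bool) where

  prefix : ℕ → ℕ
  prefix zero = 0
  prefix (suc j) = ⟦ h (suc j) ⟧ + prefix j

  prefix-at : ∀ x → h (suc x) ≡ true → prefix (suc x) ≡ suc (prefix x)
  prefix-at x e rewrite e = refl

  prefix-pos : ∀ x → h (suc x) ≡ true → 1 ≤ prefix (suc x)
  prefix-pos x e = subst (1 ≤_) (sym (prefix-at x e)) (s≤s z≤n)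

  prefix-mono : ∀ {j} j′ → j ≤ j′ → prefix j ≤ prefix j′
  prefix-mono zero z≤n = ≤-refl
  prefix-mono (suc j′) j≤1+j′ with m≤n⇒m<n∨m≡n j≤1+j′
  ... | inj₂ refl = ≤-refl
  ... | inj₁ (s≤s j≤j′) = ≤-trans (prefix-mono j′ j≤j′) (m≤n+m (prefix j′) ⟦ h (suc j′) ⟧)

  prefix-strict : ∀ {x} x′ → x < x′ → h x′ ≡ true → prefix x < prefix x′
  prefix-strict (suc x′) (s≤s x≤x′) e rewrite prefix-at x′ e = s≤s (prefix-mono x′ x≤x′)

  prefix-injective : ∀ x x′ → h x ≡ true → h x′ ≡ true → prefix x ≡ prefix x′ → x ≡ x′
  prefix-injective x x′ hx hx′ e with <-cmp x x′
  ... | tri< x<x′ _ _ = ⊥-elim (<-irrefl e (prefix-strict x′ x<x′ hx′))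
  ... | tri≈ _ x≡x′ _ = x≡x′
  ... | tri> _ _ x′<x = ⊥-elim (<-irrefl (sym e) (prefix-strict x x′<x hx))

  prefix-attains : ∀ j k → 1 ≤ k → k ≤ prefix j → Σ ℕ λ x → x ≤ j × h x ≡ true × prefix x ≡ k
  prefix-attains zero k 1≤k k≤0 with () ← ≤-trans 1≤k k≤0
  prefix-attains (suc j) k 1≤k k≤ with h (suc j) in e
  ... | false = let (x , x≤j , hx , px) = prefix-attains j k 1≤k k≤ in x , m≤n⇒m≤1+n x≤j , hx , px
  ... | true with k ℕ.≟ suc (prefix j)
  ... | yes refl = suc j , ≤-refl , e , prefix-at j e
  ... | no k≢ = let (x , x≤j , hx , px) = prefix-attains j k 1≤k (s≤s⁻¹ (≤∧≢⇒< k≤ k≢)) in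
                x , m≤n⇒m≤1+n x≤j , hx , px

vx vy : Var
vx = Fin.zero
vy = Fin.suc Fin.zero

module Connectives {u : ℕ} where

  ⊤ᶠ ⊥ᶠ : Formula u
  ⊤ᶠ = equal vx vx
  ⊥ᶠ = ¬ᶠ ⊤ᶠ

  ⌜_⌝ : Bool → Formula u
  ⌜ b ⌝ = if b then ⊤ᶠ else ⊥ᶠ

  _⇒ᶠ_ : Formula u → Formula u → Formula u
  φ ⇒ᶠ ψ = (¬ᶠ φ) ∨ᶠ ψ

  ⋁ : {A : Set} → List A → (A → Formula u) → Formula u
  ⋁ [] f = ⊥ᶠ
  ⋁ (a ∷ as) f = f a ∨ᶠ ⋁ as f

  ⋀ : {A : Set} → List A → (A → Formula u) → Formula u
  ⋀ [] f = ⊤ᶠ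
  ⋀ (a ∷ as) f = f a ∧ᶠ ⋀ as f

  ∀ᶠ ∃ᶠ ∃≤1 : Var → Formula u → Formula u
  ∀ᶠ v φ = count eq 0 v (¬ᶠ φ)
  ∃ᶠ v φ = count ge 1 v φ
  ∃≤1 v φ = count le 1 v φ

  labelled : Var → (Fin u → Bool) → Formula u
  labelled v g = ⋁ (allFin u) (λ i → pred i v ∧ᶠ ⌜ g i ⌝)

  labelled₂ : (Fin u → Fin u → Bool) → Formula u
  labelled₂ g = ⋁ (allFin u) (λ i → pred i vx ∧ᶠ labelled vy (g i))

  module Semantics (𝔄 : Structure u) where
    open Structure 𝔄

    Env : Set
    Env = Var → D 𝔄

    _⊨_ : Env → Formula u → Set
    ρ ⊨ φ = eval 𝔄 φ ρ ≡ true

    _[_↦_] : Env → Var → D 𝔄 → Env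
    ρ [ v ↦ d ] = update 𝔄 ρ v d

    ⊤ᶠ-true : ∀ ρ → ρ ⊨ ⊤ᶠ
    ⊤ᶠ-true ρ = ≟-refl (ρ vx)

    ⌜⌝-eval : ∀ b ρ → eval 𝔄 ⌜ b ⌝ ρ ≡ b
    ⌜⌝-eval true ρ = ⊤ᶠ-true ρ
    ⌜⌝-eval false ρ rewrite ⊤ᶠ-true ρ = refl

    ⇒ᶠ-elim : ∀ φ ψ ρ → ρ ⊨ (φ ⇒ᶠ ψ) → ρ ⊨ φ → ρ ⊨ ψ
    ⇒ᶠ-elim φ ψ ρ e eφ rewrite eφ = e

    ⇒ᶠ-intro : ∀ φ ψ ρ → (ρ ⊨ φ → ρ ⊨ ψ) → ρ ⊨ (φ ⇒ᶠ ψ)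
    ⇒ᶠ-intro φ ψ ρ h with eval 𝔄 φ ρ
    ... | true = h refl
    ... | false = refl

    ⋁⇒ : ∀ {A : Set} (as : List A) f ρ → ρ ⊨ ⋁ as f → Σ A λ a → ρ ⊨ f a
    ⋁⇒ [] f ρ e rewrite ⊤ᶠ-true ρ with () ← e
    ⋁⇒ (a ∷ as) f ρ e = [ (λ ea → a , ea) , ⋁⇒ as f ρ ]′ (∨-elim e)

    ⋁⇐ : ∀ {A : Set} (as : List A) f ρ a → a ∈ as → ρ ⊨ f a → ρ ⊨ ⋁ as f
    ⋁⇐ (b ∷ as) f ρ a (here refl) e = ∨-introˡ e
    ⋁⇐ (b ∷ as) f ρ a (there a∈) e = ∨-introʳ {eval 𝔄 (f b) ρ} (⋁⇐ as f ρ a a∈ e)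

    ⋀⇒ : ∀ {A : Set} (as : List A) f ρ → ρ ⊨ ⋀ as f → ∀ a → a ∈ as → ρ ⊨ f a
    ⋀⇒ (b ∷ as) f ρ e a (here refl) = ∧-elimˡ e
    ⋀⇒ (b ∷ as) f ρ e a (there a∈) = ⋀⇒ as f ρ (∧-elimʳ {eval 𝔄 (f b) ρ} e) a a∈

    ⋀⇐ : ∀ {A : Set} (as : List A) f ρ → (∀ a → ρ ⊨ f a) → ρ ⊨ ⋀ as f
    ⋀⇐ [] f ρ h = ⊤ᶠ-true ρ
    ⋀⇐ (a ∷ as) f ρ h = ∧-intro (h a) (⋀⇐ as f ρ h)

    labelled⇒ : ∀ v g ρ → ρ ⊨ labelled v g → Σ (Fin u) λ i → P i (ρ v) ≡ true × g i ≡ true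
    labelled⇒ v g ρ e with ⋁⇒ (allFin u) (λ i → pred i v ∧ᶠ ⌜ g i ⌝) ρ e
    ... | i , ei = i , ∧-elimˡ ei , trans (sym (⌜⌝-eval (g i) ρ)) (∧-elimʳ {P i (ρ v)} ei)

    labelled⇐ : ∀ v g ρ i → P i (ρ v) ≡ true → g i ≡ true → ρ ⊨ labelled v g
    labelled⇐ v g ρ i pi gi =
      ⋁⇐ (allFin u) (λ i → pred i v ∧ᶠ ⌜ g i ⌝) ρ i (∈-allFin i)
         (∧-intro pi (trans (⌜⌝-eval (g i) ρ) gi))

    ¬labelled⇒ : ∀ v g ρ → ρ ⊨ (¬ᶠ labelled v g) → ∀ i → P i (ρ v) ≡ true → g i ≡ false
    ¬labelled⇒ v g ρ e i pi with g i in gi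
    ... | false = refl
    ... | true = ⊥-elim (true≢false (labelled⇐ v g ρ i pi gi) (not≡true e))

    ¬labelled⇐ : ∀ v g ρ → (∀ i → P i (ρ v) ≡ true → g i ≡ false) → ρ ⊨ (¬ᶠ labelled v g)
    ¬labelled⇐ v g ρ h with eval 𝔄 (labelled v g) ρ in e
    ... | false = refl
    ... | true with i , pi , gi ← labelled⇒ v g ρ e = ⊥-elim (true≢false gi (h i pi))

    ¬labelled₂⇒ : ∀ g ρ → ρ ⊨ (¬ᶠ labelled₂ g) →
                  ∀ i j → P i (ρ vx) ≡ true → P j (ρ vy) ≡ true → g i j ≡ false
    ¬labelled₂⇒ g ρ e i j pi pj with g i j in gij
    ... | false = refl
    ... | true = ⊥-elim (true≢false lab₂ (not≡true e))
      where lab₂ : ρ ⊨ labelled₂ g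
            lab₂ = ⋁⇐ (allFin u) (λ i → pred i vx ∧ᶠ labelled vy (g i)) ρ i (∈-allFin i)
                     (∧-intro pi (labelled⇐ vy (g i) ρ j pj gij))

    ¬labelled₂⇐ : ∀ g ρ → (∀ i j → P i (ρ vx) ≡ true → P j (ρ vy) ≡ true → g i j ≡ false) →
                  ρ ⊨ (¬ᶠ labelled₂ g)
    ¬labelled₂⇐ g ρ h with eval 𝔄 (labelled₂ g) ρ in e
    ... | false = refl
    ... | true with i , ei ← ⋁⇒ (allFin u) (λ i → pred i vx ∧ᶠ labelled vy (g i)) ρ e
                 with j , pj , gij ← labelled⇒ vy (g i) ρ (∧-elimʳ {P i (ρ vx)} ei) =
      ⊥-elim (true≢false gij (h i j (∧-elimˡ ei) pj))

    witness : Var → Formula u → Env → D 𝔄 → Bool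
    witness v φ ρ d = eval 𝔄 φ (ρ [ v ↦ d ])

    witnesses : Var → Formula u → Env → ℕ
    witnesses v φ ρ = tally (witness v φ ρ) (allFin (suc n))

    count-eval : ∀ c k v φ ρ → eval 𝔄 (count c k v φ) ρ ≡ cmp c (witnesses v φ ρ) k
    count-eval c k v φ ρ = cong (λ w → cmp c w k) (length-filter (witness v φ ρ) (allFin (suc n)))

    ∀ᶠ⇒ : ∀ v φ ρ → ρ ⊨ ∀ᶠ v φ → ∀ d → (ρ [ v ↦ d ]) ⊨ φ
    ∀ᶠ⇒ v φ ρ e d = not≡false (tally-zero⁻ (witness v (¬ᶠ φ) ρ) (allFin (suc n))
      (does-true (_ ℕ.≟ 0) (trans (sym (count-eval eq 0 v (¬ᶠ φ) ρ)) e)) d (∈-allFin d))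

    ∀ᶠ⇐ : ∀ v φ ρ → (∀ d → (ρ [ v ↦ d ]) ⊨ φ) → ρ ⊨ ∀ᶠ v φ
    ∀ᶠ⇐ v φ ρ h = trans (count-eval eq 0 v (¬ᶠ φ) ρ)
      (dec-true (_ ℕ.≟ 0) (tally-zero (witness v (¬ᶠ φ) ρ) (allFin (suc n)) (λ d _ → cong not (h d))))

    ∃ᶠ⇒ : ∀ v φ ρ → ρ ⊨ ∃ᶠ v φ → Σ (D 𝔄) λ d → (ρ [ v ↦ d ]) ⊨ φ
    ∃ᶠ⇒ v φ ρ e = tally-pos (witness v φ ρ) (allFin (suc n))
      (does-true (1 ≤? _) (trans (sym (count-eval ge 1 v φ ρ)) e))

    ∃ᶠ⇐ : ∀ v φ ρ d → (ρ [ v ↦ d ]) ⊨ φ → ρ ⊨ ∃ᶠ v φ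
    ∃ᶠ⇐ v φ ρ d e = trans (count-eval ge 1 v φ ρ)
      (dec-true (1 ≤? _) (tally-pos⁻ (witness v φ ρ) (allFin (suc n)) d (∈-allFin d) e))

    ¬∃ᶠ⇐ : ∀ v φ ρ → (∀ d → witness v φ ρ d ≡ false) → ρ ⊨ (¬ᶠ ∃ᶠ v φ)
    ¬∃ᶠ⇐ v φ ρ h = cong not (trans (count-eval ge 1 v φ ρ)
      (cong (λ w → does (1 ≤? w)) (tally-zero (witness v φ ρ) (allFin (suc n)) (λ d _ → h d))))

    ¬∃ᶠ⇒ : ∀ v φ ρ → ρ ⊨ (¬ᶠ ∃ᶠ v φ) → ∀ d → witness v φ ρ d ≡ false
    ¬∃ᶠ⇒ v φ ρ e d with witness v φ ρ d in w
    ... | false = refl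
    ... | true = ⊥-elim (true≢false (∃ᶠ⇐ v φ ρ d w) (not≡true e))

    AtMostOne : Var → Formula u → Env → Set
    AtMostOne v φ ρ = ∀ d d′ → (ρ [ v ↦ d ]) ⊨ φ → (ρ [ v ↦ d′ ]) ⊨ φ → d ≡ d′

    ∃≤1⇒ : ∀ v φ ρ → ρ ⊨ ∃≤1 v φ → AtMostOne v φ ρ
    ∃≤1⇒ v φ ρ e d d′ = tally-≤1 (witness v φ ρ) (allFin (suc n))
      (does-true (_ ≤? 1) (trans (sym (count-eval le 1 v φ ρ)) e)) d d′ (∈-allFin d) (∈-allFin d′)

    ∃≤1⇐ : ∀ v φ ρ → AtMostOne v φ ρ → ρ ⊨ ∃≤1 v φ
    ∃≤1⇐ v φ ρ h = trans (count-eval le 1 v φ ρ)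
      (dec-true (_ ≤? 1) (tally-≤1⁻ (witness v φ ρ) (allFin (suc n)) (allFin⁺ (suc n)) h))

    ∀∀⇒ : ∀ φ ρ → ρ ⊨ ∀ᶠ vx (∀ᶠ vy φ) → ∀ a b → ((ρ [ vx ↦ a ]) [ vy ↦ b ]) ⊨ φ
    ∀∀⇒ φ ρ e a = ∀ᶠ⇒ vy φ (ρ [ vx ↦ a ]) (∀ᶠ⇒ vx (∀ᶠ vy φ) ρ e a)

    ∀∀⇐ : ∀ φ ρ → (∀ a b → ((ρ [ vx ↦ a ]) [ vy ↦ b ]) ⊨ φ) → ρ ⊨ ∀ᶠ vx (∀ᶠ vy φ)
    ∀∀⇐ φ ρ h = ∀ᶠ⇐ vx (∀ᶠ vy φ) ρ (λ a → ∀ᶠ⇐ vy φ (ρ [ vx ↦ a ]) (h a))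

module Reduction (M : MCA) where
  open MCA M public

  Label : Set
  Label = Fin (suc (length δ))

  transition : Label → Fin nQ × Op nC × Fin nQ
  transition Fin.zero = qI , skip , qI
  transition (Fin.suc t) = List.lookup δ t

  src tgt : Label → Fin nQ
  src i = proj₁ (transition i)
  tgt i = proj₂ (proj₂ (transition i))

  op : Label → Op nC
  op i = proj₁ (proj₂ (transition i))

  canFollow : Label → Label → Bool
  canFollow i Fin.zero = false
  canFollow i j@(Fin.suc _) = does (tgt i ≟ᶠ src j)

  final : Label → Bool
  final i = F (tgt i)

  isInc isDec : Fin nC → Op nC → Bool
  isInc c (inc c′) = does (c′ ≟ᶠ c)
  isInc c _ = false
  isDec c (dec c′) = does (c′ ≟ᶠ c)
  isDec c _ = false

  decrements : Op nC → Bool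
  decrements (dec _) = true
  decrements _ = false

  resetInc : Op nC → Bool
  resetInc (inc c) = R c
  resetInc _ = false

  matchable : Op nC → Op nC → Bool
  matchable (inc c) (dec c′) = does (c ≟ᶠ c′)
  matchable _ _ = false

  canFollow⇒∈δ : ∀ i j → canFollow i j ≡ true → (tgt i , op j , tgt j) ∈ δ
  canFollow⇒∈δ i (Fin.suc t) e rewrite does-true (tgt i ≟ᶠ src (Fin.suc t)) e = ∈-lookup t

  matchable⇒ : ∀ o o′ → matchable o o′ ≡ true → Σ (Fin nC) λ c → o ≡ inc c × o′ ≡ dec c
  matchable⇒ (inc c) (dec c′) e with c ≟ᶠ c′
  ... | yes refl = c , refl , refl

  matchable⇒decrements : ∀ o o′ → matchable o o′ ≡ true → decrements o′ ≡ true
  matchable⇒decrements (inc _) (dec _) _ = refl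

  ¬decrements⇒¬isDec : ∀ c o → decrements o ≡ false → isDec c o ≡ false
  ¬decrements⇒¬isDec c (inc _) _ = refl
  ¬decrements⇒¬isDec c skip _ = refl

  isInc⇒ : ∀ c o → isInc c o ≡ true → o ≡ inc c
  isInc⇒ c (inc c′) e with c′ ≟ᶠ c
  ... | yes refl = refl

  isDec⇒ : ∀ c o → isDec c o ≡ true → o ≡ dec c
  isDec⇒ c (dec c′) e with c′ ≟ᶠ c
  ... | yes refl = refl

  decrements⇒ : ∀ o → decrements o ≡ true → Σ (Fin nC) λ c → o ≡ dec c
  decrements⇒ (dec c) _ = c , refl

  resetInc⇒ : ∀ o → resetInc o ≡ true → Σ (Fin nC) λ c → o ≡ inc c × R c ≡ true
  resetInc⇒ (inc c) r = c , refl , r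

  isInc⇒resetInc : ∀ c o → isInc c o ≡ true → R c ≡ true → resetInc o ≡ true
  isInc⇒resetInc c (inc c′) e r with c′ ≟ᶠ c
  ... | yes refl = r

  open Connectives {suc (length δ)}

  succᶠ : Var → Var → Formula (suc (length δ))
  succᶠ v w = less v w ∧ᶠ bin v w

  matchᶠ : Var → Var → Formula (suc (length δ))
  matchᶠ v w = less v w ∧ᶠ bin w v

  startᶠ : Var → Formula (suc (length δ))
  startᶠ v = pred Fin.zero v

  data Axiom : Set where
    EveryLabelled StartExists StartUnique HasPredecessor SuccFollows SuccUnique
      LastFinal DecMatched DecMatchUnique MatchMatchable IncMatchUnique ResetMatched : Axiom

  axiom : Axiom → Formula (suc (length δ))
  axiom EveryLabelled = labelled vx (λ _ → true)
  axiom StartExists = ∃ᶠ vx (startᶠ vx)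
  axiom StartUnique = ∃≤1 vx (startᶠ vx)
  axiom HasPredecessor = (¬ᶠ startᶠ vx) ⇒ᶠ ∃ᶠ vy (succᶠ vy vx)
  axiom SuccFollows = succᶠ vx vy ⇒ᶠ (¬ᶠ labelled₂ (λ i j → not (canFollow i j)))
  axiom SuccUnique = ∃≤1 vy (succᶠ vx vy)
  axiom LastFinal = (¬ᶠ ∃ᶠ vy (succᶠ vx vy)) ⇒ᶠ (¬ᶠ labelled vx (not ∘ final))
  axiom DecMatched = labelled vx (decrements ∘ op) ⇒ᶠ ∃ᶠ vy (matchᶠ vy vx)
  axiom DecMatchUnique = ∃≤1 vy (matchᶠ vy vx)
  axiom MatchMatchable = matchᶠ vx vy ⇒ᶠ (¬ᶠ labelled₂ (λ i j → not (matchable (op i) (op j))))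
  axiom IncMatchUnique = ∃≤1 vy (matchᶠ vx vy)
  axiom ResetMatched = labelled vx (resetInc ∘ op) ⇒ᶠ ∃ᶠ vy (matchᶠ vx vy)

  allAxioms : List Axiom
  allAxioms = EveryLabelled ∷ StartExists ∷ StartUnique ∷ HasPredecessor ∷ SuccFollows ∷ SuccUnique
            ∷ LastFinal ∷ DecMatched ∷ DecMatchUnique ∷ MatchMatchable ∷ IncMatchUnique ∷ ResetMatched ∷ []

  ∈-allAxioms : ∀ ax → ax ∈ allAxioms
  ∈-allAxioms EveryLabelled = here refl
  ∈-allAxioms StartExists = there (here refl)
  ∈-allAxioms StartUnique = there (there (here refl))
  ∈-allAxioms HasPredecessor = there (there (there (here refl)))
  ∈-allAxioms SuccFollows = there (there (there (there (here refl))))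
  ∈-allAxioms SuccUnique = there (there (there (there (there (here refl)))))
  ∈-allAxioms LastFinal = there (there (there (there (there (there (here refl))))))
  ∈-allAxioms DecMatched = there (there (there (there (there (there (there (here refl)))))))
  ∈-allAxioms DecMatchUnique = there (there (there (there (there (there (there (there (here refl))))))))
  ∈-allAxioms MatchMatchable = there (there (there (there (there (there (there (there (there (here refl)))))))))
  ∈-allAxioms IncMatchUnique =
    there (there (there (there (there (there (there (there (there (there (here refl))))))))))
  ∈-allAxioms ResetMatched =
    there (there (there (there (there (there (there (there (there (there (there (here refl)))))))))))

  Φ : Formula (suc (length δ))
  Φ = ∀ᶠ vx (∀ᶠ vy (⋀ allAxioms axiom))

  Φ-closed : Closed Φ
  Φ-closed Fin.zero = refl
  Φ-closed (Fin.suc Fin.zero) = refl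

  sentenceOf : Sentence
  sentenceOf = sentence (suc (length δ)) Φ Φ-closed

  module Reading (𝔄 : Structure (suc (length δ))) where
    open Structure 𝔄
    open Semantics 𝔄

    Dom : Set
    Dom = D 𝔄

    HasLabel : Dom → Label → Set
    HasLabel a i = P i a ≡ true

    succ match : Dom → Dom → Bool
    succ a b = Lt a b ∧ B a b
    match a b = Lt a b ∧ B b a

    record Axioms : Set where
      field
        labelled-all     : ∀ a → Σ Label (HasLabel a)
        start-exists     : Σ Dom λ a → HasLabel a Fin.zero
        start-unique     : ∀ a a′ → HasLabel a Fin.zero → HasLabel a′ Fin.zero → a ≡ a′
        has-predecessor  : ∀ a → P Fin.zero a ≡ false → Σ Dom λ b → succ b a ≡ true
        succ-follows     : ∀ a b → succ a b ≡ true → ∀ i j → HasLabel a i → HasLabel b j →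
                           canFollow i j ≡ true
        succ-unique      : ∀ a b b′ → succ a b ≡ true → succ a b′ ≡ true → b ≡ b′
        last-final       : ∀ a → (∀ b → succ a b ≡ false) → ∀ i → HasLabel a i → final i ≡ true
        dec-matched      : ∀ a i → HasLabel a i → decrements (op i) ≡ true → Σ Dom λ b → match b a ≡ true
        dec-match-unique : ∀ a b b′ → match b a ≡ true → match b′ a ≡ true → b ≡ b′
        match-matchable  : ∀ a b → match a b ≡ true → ∀ i j → HasLabel a i → HasLabel b j →
                           matchable (op i) (op j) ≡ true
        inc-match-unique : ∀ a b b′ → match a b ≡ true → match a b′ ≡ true → b ≡ b′
        reset-matched    : ∀ a i → HasLabel a i → resetInc (op i) ≡ true → Σ Dom λ b → match a b ≡ true

    ρ₀ : Env
    ρ₀ _ = Fin.zero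

    at : Dom → Dom → Env
    at a b = (ρ₀ [ vx ↦ a ]) [ vy ↦ b ]


    module FromΦ (sat : ρ₀ ⊨ Φ) where
      holds : ∀ ax a b → at a b ⊨ axiom ax
      holds ax a b = ⋀⇒ allAxioms axiom (at a b) (∀∀⇒ (⋀ allAxioms axiom) ρ₀ sat a b) ax (∈-allAxioms ax)

      implied : ∀ ax a b φ ψ → axiom ax ≡ (φ ⇒ᶠ ψ) → at a b ⊨ φ → at a b ⊨ ψ
      implied ax a b φ ψ e = ⇒ᶠ-elim φ ψ (at a b) (subst (at a b ⊨_) e (holds ax a b))

      labelled-all : ∀ a → Σ Label (HasLabel a)
      labelled-all a = let (i , p , _) = labelled⇒ vx (λ _ → true) (at a a) (holds EveryLabelled a a) in i , p

      start-exists : Σ Dom λ a → HasLabel a Fin.zero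
      start-exists = ∃ᶠ⇒ vx (startᶠ vx) (at Fin.zero Fin.zero) (holds StartExists Fin.zero Fin.zero)

      start-unique : ∀ a a′ → HasLabel a Fin.zero → HasLabel a′ Fin.zero → a ≡ a′
      start-unique = ∃≤1⇒ vx (startᶠ vx) (at Fin.zero Fin.zero) (holds StartUnique Fin.zero Fin.zero)

      has-predecessor : ∀ a → P Fin.zero a ≡ false → Σ Dom λ b → succ b a ≡ true
      has-predecessor a p = ∃ᶠ⇒ vy (succᶠ vy vx) (at a a) (implied HasPredecessor a a _ _ refl (not-false p))

      succ-follows : ∀ a b → succ a b ≡ true → ∀ i j → HasLabel a i → HasLabel b j → canFollow i j ≡ true
      succ-follows a b s i j pi pj =
        not≡false (¬labelled₂⇒ _ (at a b) (implied SuccFollows a b _ _ refl s) i j pi pj)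

      succ-unique : ∀ a b b′ → succ a b ≡ true → succ a b′ ≡ true → b ≡ b′
      succ-unique a = ∃≤1⇒ vy (succᶠ vx vy) (at a a) (holds SuccUnique a a)

      last-final : ∀ a → (∀ b → succ a b ≡ false) → ∀ i → HasLabel a i → final i ≡ true
      last-final a none i pi = not≡false (¬labelled⇒ vx (not ∘ final) (at a a)
        (implied LastFinal a a _ _ refl (¬∃ᶠ⇐ vy (succᶠ vx vy) (at a a) none)) i pi)

      dec-matched : ∀ a i → HasLabel a i → decrements (op i) ≡ true → Σ Dom λ b → match b a ≡ true
      dec-matched a i pi d = ∃ᶠ⇒ vy (matchᶠ vy vx) (at a a)
        (implied DecMatched a a _ _ refl (labelled⇐ vx (decrements ∘ op) (at a a) i pi d))

      dec-match-unique : ∀ a b b′ → match b a ≡ true → match b′ a ≡ true → b ≡ b′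
      dec-match-unique a = ∃≤1⇒ vy (matchᶠ vy vx) (at a a) (holds DecMatchUnique a a)

      match-matchable : ∀ a b → match a b ≡ true → ∀ i j → HasLabel a i → HasLabel b j →
                        matchable (op i) (op j) ≡ true
      match-matchable a b m i j pi pj =
        not≡false (¬labelled₂⇒ _ (at a b) (implied MatchMatchable a b _ _ refl m) i j pi pj)

      inc-match-unique : ∀ a b b′ → match a b ≡ true → match a b′ ≡ true → b ≡ b′
      inc-match-unique a = ∃≤1⇒ vy (matchᶠ vx vy) (at a a) (holds IncMatchUnique a a)

      reset-matched : ∀ a i → HasLabel a i → resetInc (op i) ≡ true → Σ Dom λ b → match a b ≡ true
      reset-matched a i pi r = ∃ᶠ⇒ vy (matchᶠ vx vy) (at a a)
        (implied ResetMatched a a _ _ refl (labelled⇐ vx (resetInc ∘ op) (at a a) i pi r))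

    axioms-sound : ρ₀ ⊨ Φ → Axioms
    axioms-sound sat = record { FromΦ sat }

    module ToΦ (axs : Axioms) where
      open Axioms axs

      implication : ∀ ax a b φ ψ → axiom ax ≡ (φ ⇒ᶠ ψ) →
                    (at a b ⊨ φ → at a b ⊨ ψ) → at a b ⊨ axiom ax
      implication ax a b φ ψ e h = subst (at a b ⊨_) (sym e) (⇒ᶠ-intro φ ψ (at a b) h)

      holds : ∀ ax a b → at a b ⊨ axiom ax
      holds EveryLabelled a b = let (i , p) = labelled-all a in labelled⇐ vx (λ _ → true) (at a b) i p refl
      holds StartExists a b = ∃ᶠ⇐ vx (startᶠ vx) (at a b) (proj₁ start-exists) (proj₂ start-exists)
      holds StartUnique a b = ∃≤1⇐ vx (startᶠ vx) (at a b) start-unique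
      holds HasPredecessor a b = implication HasPredecessor a b _ _ refl λ p →
        let (c , s) = has-predecessor a (not≡true p) in ∃ᶠ⇐ vy (succᶠ vy vx) (at a b) c s
      holds SuccFollows a b = implication SuccFollows a b _ _ refl λ s →
        ¬labelled₂⇐ _ (at a b) λ i j pi pj → cong not (succ-follows a b s i j pi pj)
      holds SuccUnique a b = ∃≤1⇐ vy (succᶠ vx vy) (at a b) (succ-unique a)
      holds LastFinal a b = implication LastFinal a b _ _ refl λ none →
        ¬labelled⇐ vx (not ∘ final) (at a b) λ i pi →
        cong not (last-final a (¬∃ᶠ⇒ vy (succᶠ vx vy) (at a b) none) i pi)
      holds DecMatched a b = implication DecMatched a b _ _ refl λ l →
        let (i , pi , d) = labelled⇒ vx (decrements ∘ op) (at a b) l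
            (c , m) = dec-matched a i pi d
        in ∃ᶠ⇐ vy (matchᶠ vy vx) (at a b) c m
      holds DecMatchUnique a b = ∃≤1⇐ vy (matchᶠ vy vx) (at a b) (dec-match-unique a)
      holds MatchMatchable a b = implication MatchMatchable a b _ _ refl λ m →
        ¬labelled₂⇐ _ (at a b) λ i j pi pj → cong not (match-matchable a b m i j pi pj)
      holds IncMatchUnique a b = ∃≤1⇐ vy (matchᶠ vx vy) (at a b) (inc-match-unique a)
      holds ResetMatched a b = implication ResetMatched a b _ _ refl λ l →
        let (i , pi , r) = labelled⇒ vx (resetInc ∘ op) (at a b) l
            (c , m) = reset-matched a i pi r
        in ∃ᶠ⇐ vy (matchᶠ vx vy) (at a b) c m

    axioms-complete : Axioms → ρ₀ ⊨ Φ
    axioms-complete axs =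
      ∀∀⇐ (⋀ allAxioms axiom) ρ₀ λ a b → ⋀⇐ allAxioms axiom (at a b) λ ax → ToΦ.holds axs ax a b

module Effects (M : MCA) where
  open Reduction M

  Balanced : Op nC → Vec ℕ nC → Vec ℕ nC → Set
  Balanced o v v′ = ∀ c → lookup v′ c + ⟦ isDec c o ⟧ ≡ lookup v c + ⟦ isInc c o ⟧

  step⇒balanced : ∀ {p v q v′} → Step M (p , v) (q , v′) →
                  Σ (Op nC) λ o → (p , o , q) ∈ δ × Balanced o v v′
  step⇒balanced (inc-step {c = c} {v = v} mem) = inc c , mem , balanced
    where balanced : Balanced (inc c) v (v [ c ]%= suc)
          balanced c′ with c ≟ᶠ c′
          ... | yes refl = trans (+-identityʳ _) (trans (lookup∘updateAt c v) (+-comm 1 (lookup v c)))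
          ... | no c≢c′ = cong (_+ 0) (lookup∘updateAt′ c′ c (c≢c′ ∘ sym) v)
  step⇒balanced (dec-step {c = c} {v = v} {m = m} mem v[c]≡1+m) = dec c , mem , balanced
    where balanced : Balanced (dec c) v (v [ c ]≔ m)
          balanced c′ with c ≟ᶠ c′
          ... | yes refl = begin
            lookup (v [ c ]≔ m) c + 1 ≡⟨ cong (_+ 1) (lookup∘updateAt c v) ⟩
            m + 1                     ≡⟨ +-comm m 1 ⟩
            suc m                     ≡⟨ sym v[c]≡1+m ⟩
            lookup v c                ≡⟨ sym (+-identityʳ _) ⟩
            lookup v c + 0            ∎
            where open ≡-Reasoning
          ... | no c≢c′ = cong (_+ 0) (lookup∘updateAt′ c′ c (c≢c′ ∘ sym) v)
  step⇒balanced (skip-step mem) = skip , mem , λ c → refl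

  balanced⇒step : ∀ {p o q v v′} → (p , o , q) ∈ δ → Balanced o v v′ → Step M (p , v) (q , v′)
  balanced⇒step {p} {skip} {q} {v} {v′} mem balanced =
    subst (λ w → Step M (p , v) (q , w)) (vec-ext λ c → sym (m+0≡n+0⇒m≡n (balanced c))) (skip-step mem)
  balanced⇒step {p} {inc c} {q} {v} {v′} mem balanced =
    subst (λ w → Step M (p , v) (q , w)) (sym (vec-ext at)) (inc-step mem)
    where at : ∀ c′ → lookup v′ c′ ≡ lookup (v [ c ]%= suc) c′
          at c′ with c ≟ᶠ c′ | balanced c′
          ... | yes refl | e = trans (m+0≡n+1⇒m≡1+n e) (sym (lookup∘updateAt c v))
          ... | no c≢c′ | e = trans (m+0≡n+0⇒m≡n e) (sym (lookup∘updateAt′ c′ c (c≢c′ ∘ sym) v))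
  balanced⇒step {p} {dec c} {q} {v} {v′} mem balanced =
    subst (λ w → Step M (p , v) (q , w)) (sym (vec-ext at)) (dec-step mem v[c]≡1+v′[c])
    where v[c]≡1+v′[c] : lookup v c ≡ suc (lookup v′ c)
          v[c]≡1+v′[c] with c ≟ᶠ c | balanced c
          ... | yes _ | e = m+0≡n+1⇒m≡1+n (sym e)
          ... | no c≢c | _ = ⊥-elim (c≢c refl)
          at : ∀ c′ → lookup v′ c′ ≡ lookup (v [ c ]≔ lookup v′ c) c′
          at c′ with c ≟ᶠ c′ | balanced c′
          ... | yes refl | _ = sym (lookup∘updateAt c v)
          ... | no c≢c′ | e = trans (m+0≡n+0⇒m≡n e) (sym (lookup∘updateAt′ c′ c (c≢c′ ∘ sym) v))

  balanced-positive : ∀ {o v v′} c → Balanced o v v′ → isDec c o ≡ true → 1 ≤ lookup v c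
  balanced-positive {dec c′} {v} {v′} c balanced d with c′ ≟ᶠ c | balanced c
  ... | yes refl | e = subst (1 ≤_) (trans (+-comm 1 (lookup v′ c)) (trans e (+-identityʳ _))) (s≤s z≤n)
  ... | no _ | _ = ⊥-elim (true≢false d refl)

module Soundness (M : MCA) where
  open Reduction M
  open Effects M

  module _ (𝔄 : Structure (suc (length δ))) (slo : IsStrictLinearOrder (Structure.Lt 𝔄))
           (axs : Reading.Axioms 𝔄) where
    open Structure 𝔄
    open Reading 𝔄
    open Axioms axs
    open StrictLinearOrder Lt slo

    elements : List Dom
    elements = allFin (suc n)

    start : Dom
    start = proj₁ start-exists

    is-start : ∀ a → HasLabel a Fin.zero → a ≡ start
    is-start a p = start-unique a start p (proj₂ start-exists)

    lab : Dom → Label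
    lab a = if P Fin.zero a then Fin.zero else proj₁ (labelled-all a)

    lab-has : ∀ a → HasLabel a (lab a)
    lab-has a with P Fin.zero a in e
    ... | true = e
    ... | false = proj₂ (labelled-all a)

    lab-start : lab start ≡ Fin.zero
    lab-start rewrite proj₂ start-exists = refl

    succ⇒≺ : ∀ {a b} → succ a b ≡ true → Lt a b ≡ true
    succ⇒≺ = ∧-elimˡ

    -- Following predecessors from any element leads back to the start.
    start-least : ∀ a → start ≼ a ≡ true
    start-least = induction _ step
      where
      step : ∀ a → (∀ b → Lt b a ≡ true → start ≼ b ≡ true) → start ≼ a ≡ true
      step a ih with P Fin.zero a in e
      ... | true = ≡⇒≼ (sym (is-start a e))
      ... | false = let (b , sba) = has-predecessor a e in
                    ≺⇒≼ (≼-≺-trans (ih b (succ⇒≺ sba)) (succ⇒≺ sba))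

    NotInGap : Dom → Set
    NotInGap x = ∀ w z → succ w z ≡ true → Lt w x ≡ true → Lt x z ≡ true → ⊥

    no-gap : ∀ x → NotInGap x
    no-gap = induction NotInGap step
      where
      step : ∀ x → (∀ x′ → Lt x′ x ≡ true → NotInGap x′) → NotInGap x
      step x ih w z swz w≺x x≺z with P Fin.zero x in e
      ... | true = ≺⇒≢ (≼-≺-trans (start-least w) w≺x) (sym (is-start x e))
      ... | false with has-predecessor x e
      ... | x′ , sx′x with compare x′ w
      ... | inj₁ refl = ≺⇒≢ x≺z (succ-unique x′ x z sx′x swz)
      ... | inj₂ (inj₁ x′≺w) = ih w w≺x x′ x sx′x x′≺w w≺x
      ... | inj₂ (inj₂ w≺x′) = let x′≺x = succ⇒≺ sx′x in
                               ih x′ x′≺x w z swz w≺x′ (≺-trans x′ x z x′≺x x≺z)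

    consumedBy : Dom → Dom → Bool
    consumedBy w x = does (1 ≤? tally (λ y → match x y ∧ (y ≼ w)) elements)

    consumed⇒ : ∀ w x → consumedBy w x ≡ true → Σ Dom λ y → match x y ∧ (y ≼ w) ≡ true
    consumed⇒ w x e = tally-pos (λ y → match x y ∧ (y ≼ w)) elements (does-true (1 ≤? _) e)

    consumed⇐ : ∀ w x y → match x y ≡ true → y ≼ w ≡ true → consumedBy w x ≡ true
    consumed⇐ w x y m y≼w =
      dec-true (1 ≤? _) (tally-pos⁻ (λ y → match x y ∧ (y ≼ w)) elements y (∈-allFin y) (∧-intro m y≼w))
    ¬consumed-self : ∀ w → consumedBy w w ≡ false
    ¬consumed-self w with consumedBy w w in e
    ... | false = refl
    ... | true = let (y , h) = consumed⇒ w w e in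
                 ⊥-elim (true≢false (≼-≺-trans (∧-elimʳ {match w y} h) (∧-elimˡ (∧-elimˡ h)))
                                    (≺-irrefl y))

    pending : Dom → Fin nC → Dom → Bool
    pending w c x = isInc c (op (lab x)) ∧ ((x ≼ w) ∧ not (consumedBy w x))

    counter : Dom → Fin nC → ℕ
    counter w c = tally (pending w c) elements

    counters : Dom → Vec ℕ nC
    counters w = tabulate (counter w)

    counters-start : counters start ≡ replicate nC 0
    counters-start = vec-ext λ c → trans (lookup∘tabulate (counter start) c)
      (trans (tally-zero (pending start c) elements (λ x _ → not-pending c x (≼⇒ (start-least x))))
             (sym (lookup-replicate c 0)))
      where
      not-pending : ∀ c x → Lt start x ≡ true ⊎ start ≡ x → pending start c x ≡ false
      not-pending c x (inj₁ s≺x) rewrite ≺⇒¬≽ s≺x = ∧-zeroʳ _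
      not-pending c x (inj₂ refl) rewrite lab-start = refl

    module SuccLink {v w} (svw : succ v w ≡ true) where
      v≺w : Lt v w ≡ true
      v≺w = succ⇒≺ svw

      ≼w≡≼v : ∀ x → x ≢ w → x ≼ w ≡ x ≼ v
      ≼w≡≼v x x≢w = bool-ext to (λ x≼v → ≺⇒≼ (≼-≺-trans x≼v v≺w))
        where
        to : x ≼ w ≡ true → x ≼ v ≡ true
        to x≼w with ≼⇒ x≼w
        ... | inj₂ x≡w = ⊥-elim (x≢w x≡w)
        ... | inj₁ x≺w with compare x v
        ... | inj₁ x≡v = ≡⇒≼ x≡v
        ... | inj₂ (inj₁ x≺v) = ≺⇒≼ x≺v
        ... | inj₂ (inj₂ v≺x) = ⊥-elim (no-gap x v w svw v≺x x≺w)

      consumed-step : ∀ x → match x w ≡ false → consumedBy w x ≡ consumedBy v x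
      consumed-step x ¬xw = bool-ext to from
        where
        to : consumedBy w x ≡ true → consumedBy v x ≡ true
        to e = let (y , h) = consumed⇒ w x e in via y h (y ≟ᶠ w)
          where
          via : ∀ y → match x y ∧ (y ≼ w) ≡ true → Dec (y ≡ w) → consumedBy v x ≡ true
          via y h (yes refl) = ⊥-elim (true≢false (∧-elimˡ h) ¬xw)
          via y h (no y≢w) =
            consumed⇐ v x y (∧-elimˡ h) (trans (sym (≼w≡≼v y y≢w)) (∧-elimʳ {match x y} h))
        from : consumedBy v x ≡ true → consumedBy w x ≡ true
        from e = let (y , h) = consumed⇒ v x e in
                 consumed⇐ w x y (∧-elimˡ h) (≺⇒≼ (≼-≺-trans (∧-elimʳ {match x y} h) v≺w))

      pending-step : ∀ c x → x ≢ w → match x w ≡ false → pending w c x ≡ pending v c x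
      pending-step c x x≢w ¬xw rewrite ≼w≡≼v x x≢w | consumed-step x ¬xw = refl

      pending-v-w : ∀ c → pending v c w ≡ false
      pending-v-w c rewrite ≺⇒¬≽ v≺w = ∧-zeroʳ _

      pending-w-w : ∀ c → pending w c w ≡ isInc c (op (lab w))
      pending-w-w c rewrite ≼-refl w | ¬consumed-self w = ∧-identityʳ _

      Counts : Fin nC → Set
      Counts c = counter w c + ⟦ isDec c (op (lab w)) ⟧ ≡ counter v c + ⟦ isInc c (op (lab w)) ⟧

      -- w decrements nothing: only the increment at w itself is new.
      unmatched-counts : (∀ x → match x w ≡ false) → ∀ c → isDec c (op (lab w)) ≡ false → Counts c
      unmatched-counts none c ¬dec rewrite ¬dec = begin
        counter w c + 0                         ≡⟨ +-identityʳ _ ⟩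
        counter w c                             ≡⟨ tally-insert (pending v c) (pending w c) elements (allFin⁺ _) w
                                                     (∈-allFin w) (pending-v-w c)
                                                     (λ x x≢w → sym (pending-step c x x≢w (none x))) ⟩
        ⟦ pending w c w ⟧ + counter v c         ≡⟨ cong (λ b → ⟦ b ⟧ + counter v c) (pending-w-w c) ⟩
        ⟦ isInc c (op (lab w)) ⟧ + counter v c  ≡⟨ +-comm _ (counter v c) ⟩
        counter v c + ⟦ isInc c (op (lab w)) ⟧  ∎
        where open ≡-Reasoning

      -- w decrements the counter of the increment x₀ it consumes.
      matched-counts : ∀ x₀ → match x₀ w ≡ true → ∀ c → Counts c
      matched-counts x₀ m c
        with c₀ , opx₀ , opw ← matchable⇒ (op (lab x₀)) (op (lab w))
               (match-matchable x₀ w m (lab x₀) (lab w) (lab-has x₀) (lab-has w)) rewrite opw = begin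
        counter w c + ⟦ isDec c (dec c₀) ⟧       ≡⟨ +-comm (counter w c) _ ⟩
        ⟦ isInc c (inc c₀) ⟧ + counter w c       ≡⟨ cong (λ o → ⟦ isInc c o ⟧ + counter w c) (sym opx₀) ⟩
        ⟦ isInc c (op (lab x₀)) ⟧ + counter w c  ≡⟨ cong (λ b → ⟦ b ⟧ + counter w c) (sym pending-v-x₀) ⟩
        ⟦ pending v c x₀ ⟧ + counter w c         ≡⟨ sym (tally-insert (pending w c) (pending v c) elements
                                                      (allFin⁺ _) x₀ (∈-allFin x₀) pending-w-x₀ others) ⟩
        counter v c                              ≡⟨ sym (+-identityʳ _) ⟩
        counter v c + 0                          ∎
        where
        open ≡-Reasoning
        x₀≺w : Lt x₀ w ≡ true
        x₀≺w = ∧-elimˡ m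

        pending-w-x₀ : pending w c x₀ ≡ false
        pending-w-x₀ rewrite consumed⇐ w x₀ w m (≼-refl w) | ∧-zeroʳ (x₀ ≼ w) = ∧-zeroʳ _

        not-consumed : consumedBy v x₀ ≡ false
        not-consumed with consumedBy v x₀ in e
        ... | false = refl
        ... | true with consumed⇒ v x₀ e
        ... | y , h with inc-match-unique x₀ y w (∧-elimˡ h) m
        ... | refl = ⊥-elim (true≢false (∧-elimʳ {match x₀ w} h) (≺⇒¬≽ v≺w))

        pending-v-x₀ : pending v c x₀ ≡ isInc c (op (lab x₀))
        pending-v-x₀ rewrite sym (≼w≡≼v x₀ (≺⇒≢ x₀≺w)) | ≺⇒≼ x₀≺w | not-consumed =
          ∧-identityʳ _

        others : ∀ x → x ≢ x₀ → pending w c x ≡ pending v c x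
        others x x≢x₀ = by-cases (x ≟ᶠ w)
          where
          by-cases : Dec (x ≡ w) → pending w c x ≡ pending v c x
          by-cases (yes refl) = trans (pending-w-w c) (trans (cong (isInc c) opw) (sym (pending-v-w c)))
          by-cases (no x≢w) = pending-step c x x≢w ¬xw
            where ¬xw : match x w ≡ false
                  ¬xw with match x w in e
                  ... | false = refl
                  ... | true = ⊥-elim (x≢x₀ (dec-match-unique w x x₀ e m))

      counts : ∀ c → Counts c
      counts c with decrements (op (lab w)) in d
      ... | true = let (x₀ , m) = dec-matched w (lab w) (lab-has w) d in matched-counts x₀ m c
      ... | false = unmatched-counts none c (¬decrements⇒¬isDec c (op (lab w)) d)
        where
        none : ∀ x → match x w ≡ false
        none x with match x w in e
        ... | false = refl
        ... | true = ⊥-elim (true≢false (matchable⇒decrements (op (lab x)) (op (lab w))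
                       (match-matchable x w e (lab x) (lab w) (lab-has x) (lab-has w))) d)

      balanced : Balanced (op (lab w)) (counters v) (counters w)
      balanced c rewrite lookup∘tabulate (counter v) c | lookup∘tabulate (counter w) c = counts c

    Reached : Dom → Set
    Reached w = Star (Step M) (qI , replicate nC 0) (tgt (lab w) , counters w)

    reach : ∀ w → Reached w
    reach = induction Reached step
      where
      step : ∀ w → (∀ v → Lt v w ≡ true → Reached v) → Reached w
      step w ih = by-cases (false-or-true (P Fin.zero w))
        where
        from-start : Reached start
        from-start rewrite lab-start | counters-start = ε

        by-cases : P Fin.zero w ≡ false ⊎ P Fin.zero w ≡ true → Reached w
        by-cases (inj₂ e) = subst Reached (sym (is-start w e)) from-start
        by-cases (inj₁ e) =
          let (v , svw) = has-predecessor w e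
              follows = succ-follows v w svw (lab v) (lab w) (lab-has v) (lab-has w)
              last-step = balanced⇒step (canFollow⇒∈δ (lab v) (lab w) follows) (SuccLink.balanced svw)
          in ih v (succ⇒≺ svw) ◅◅ (last-step ◅ ε)

    -- The run up to the greatest element is accepting.
    accepting : HasAcceptingRun M
    accepting = tgt (lab top) , counters top , reach top ,
                last-final top no-successor (lab top) (lab-has top) , resets-zero
      where
      top : Dom
      top = proj₁ (maximum start)

      below-top : ∀ b → b ≼ top ≡ true
      below-top = proj₂ (maximum start)

      no-successor : ∀ b → succ top b ≡ false
      no-successor b with succ top b in e
      ... | false = refl
      ... | true = ⊥-elim (true≢false (≼-≺-trans (below-top b) (succ⇒≺ e)) (≺-irrefl b))

      resets-zero : ∀ c → R c ≡ true → lookup (counters top) c ≡ 0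
      resets-zero c r =
        trans (lookup∘tabulate (counter top) c) (tally-zero (pending top c) elements (λ x _ → consumed x))
        where
        consumed : ∀ x → pending top c x ≡ false
        consumed x with isInc c (op (lab x)) in i
        ... | false = refl
        ... | true = let (y , m) = reset-matched x (lab x) (lab-has x) (isInc⇒resetInc c (op (lab x)) i r) in
                     trans (cong (λ b → (x ≼ top) ∧ not b) (consumed⇐ top x y m (below-top y))) (∧-zeroʳ _)

module Completeness (M : MCA) where
  open Reduction M
  open Effects M

  Trace : Set
  Trace = List (Fin (length δ))

  -- The label of position j: position 0 is the start, position j ≥ 1 the
  -- j-th transition; positions past the end get the start label.
  labelAt : Trace → ℕ → Label
  labelAt ts zero = Fin.zero
  labelAt [] (suc j) = Fin.zero
  labelAt (t ∷ ts) (suc zero) = Fin.suc t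
  labelAt (t ∷ ts) (suc (suc j)) = labelAt ts (suc j)

  labelAt-inside : ∀ ts j → j < length ts → Σ (Fin (length δ)) λ t → labelAt ts (suc j) ≡ Fin.suc t
  labelAt-inside (t ∷ ts) zero _ = t , refl
  labelAt-inside (t ∷ ts) (suc j) (s≤s j<) = labelAt-inside ts j j<

  incs decs : Trace → Fin nC → ℕ → ℕ
  incs ts c = PrefixCount.prefix (λ j → isInc c (op (labelAt ts j)))
  decs ts c = PrefixCount.prefix (λ j → isDec c (op (labelAt ts j)))

  prefix-cons : ∀ (g : Label → Bool) t ts j → PrefixCount.prefix (λ k → g (labelAt (t ∷ ts) k)) (suc j) ≡
                             ⟦ g (Fin.suc t) ⟧ + PrefixCount.prefix (λ k → g (labelAt ts k)) j
  prefix-cons g t ts zero = refl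
  prefix-cons g t ts (suc j) =
    trans (cong (⟦ g (labelAt ts (suc j)) ⟧ +_) (prefix-cons g t ts j))
          (x∙yz≈y∙xz ⟦ g (labelAt ts (suc j)) ⟧ ⟦ g (Fin.suc t) ⟧ _)

  incs-cons : ∀ t ts c j → incs (t ∷ ts) c (suc j) ≡ ⟦ isInc c (op (Fin.suc t)) ⟧ + incs ts c j
  incs-cons t ts c = prefix-cons (λ i → isInc c (op i)) t ts

  decs-cons : ∀ t ts c j → decs (t ∷ ts) c (suc j) ≡ ⟦ isDec c (op (Fin.suc t)) ⟧ + decs ts c j
  decs-cons t ts c = prefix-cons (λ i → isDec c (op i)) t ts

  Path : Fin nQ → Trace → Fin nQ → Set
  Path p [] q = p ≡ q
  Path p (t ∷ ts) q = src (Fin.suc t) ≡ p × Path (tgt (Fin.suc t)) ts q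

  path-follows : ∀ {p q} ts → Path p ts q → ∀ j → suc j < length ts →
                 canFollow (labelAt ts (suc j)) (labelAt ts (suc (suc j))) ≡ true
  path-follows (t ∷ t′ ∷ ts) (_ , e , _) zero _ rewrite e = ≟-refl (tgt (Fin.suc t))
  path-follows (t ∷ ts) (_ , path) (suc j) (s≤s j<) = path-follows ts path j j<

  path-follows₀ : ∀ {q} ts → Path qI ts q → ∀ j → j < length ts →
                  canFollow (labelAt ts j) (labelAt ts (suc j)) ≡ true
  path-follows₀ (t ∷ ts) (e , _) zero _ rewrite e = ≟-refl qI
  path-follows₀ ts path (suc j) j< = path-follows ts path j j<

  path-last : ∀ {p q} t ts → Path p (t ∷ ts) q → tgt (labelAt (t ∷ ts) (length (t ∷ ts))) ≡ q
  path-last t [] (_ , e) = e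
  path-last t (t′ ∷ ts) (_ , path) = path-last t′ ts path

  path-final : ∀ {q} ts → Path qI ts q → F q ≡ true → final (labelAt ts (length ts)) ≡ true
  path-final [] refl f = f
  path-final (t ∷ ts) path f = subst (λ q → F q ≡ true) (sym (path-last t ts path)) f

  -- A run from (p , v) to (q , v′), recorded as a trace: along it the
  -- counters stay nonnegative, and v′ is v plus increments minus decrements.
  record RunTrace (p : Fin nQ) (v : Vec ℕ nC) (q : Fin nQ) (v′ : Vec ℕ nC) : Set where
    field
      trace   : Trace
      path    : Path p trace q
      enabled : ∀ j c → isDec c (op (labelAt trace (suc j))) ≡ true →
                decs trace c j < lookup v c + incs trace c j
      balance : ∀ c → lookup v′ c + decs trace c (length trace) ≡ lookup v c + incs trace c (length trace)

  rebalance : ∀ a b v v″ y → v″ + a ≡ v + b → a + (v″ + y) ≡ v + (b + y)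
  rebalance a b v v″ y e = begin
    a + (v″ + y)  ≡⟨ x∙yz≈y∙xz a v″ y ⟩
    v″ + (a + y)  ≡⟨ sym (+-assoc v″ a y) ⟩
    v″ + a + y    ≡⟨ cong (_+ y) e ⟩
    v + b + y     ≡⟨ +-assoc v b y ⟩
    v + (b + y)   ∎
    where open ≡-Reasoning

  runTrace : ∀ {a b} → Star (Step M) a b → RunTrace (proj₁ a) (proj₂ a) (proj₁ b) (proj₂ b)
  runTrace ε = record { trace = [] ; path = refl ; enabled = λ j c () ; balance = λ c → refl }
  runTrace {p , v} {q , v′} (_◅_ {j = p′ , v″} s rest) = record
    { trace = t ∷ trace
    ; path = cong proj₁ t-is , subst (λ r → Path r trace q) (sym (cong (proj₂ ∘ proj₂) t-is)) path
    ; enabled = enabled′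
    ; balance = balance′
    }
    where
    open RunTrace (runTrace rest)
    first = step⇒balanced s
    mem = proj₁ (proj₂ first)
    t = index mem

    t-is : transition (Fin.suc t) ≡ (p , proj₁ first , p′)
    t-is = sym (lookup-index mem)

    balanced : Balanced (op (Fin.suc t)) v v″
    balanced = subst (λ o → Balanced o v v″) (sym (cong (proj₁ ∘ proj₂) t-is)) (proj₂ (proj₂ first))

    dec₁ inc₁ : Fin nC → ℕ
    dec₁ c = ⟦ isDec c (op (Fin.suc t)) ⟧
    inc₁ c = ⟦ isInc c (op (Fin.suc t)) ⟧

    enabled′ : ∀ j c → isDec c (op (labelAt (t ∷ trace) (suc j))) ≡ true →
               decs (t ∷ trace) c j < lookup v c + incs (t ∷ trace) c j
    enabled′ zero c d =
      subst (1 ≤_) (sym (+-identityʳ _)) (balanced-positive {op (Fin.suc t)} {v} {v″} c balanced d)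
    enabled′ (suc j) c d = begin-strict
      decs (t ∷ trace) c (suc j)                ≡⟨ decs-cons t trace c j ⟩
      dec₁ c + decs trace c j                   <⟨ +-monoʳ-< (dec₁ c) (enabled j c d) ⟩
      dec₁ c + (lookup v″ c + incs trace c j)   ≡⟨ rebalance _ _ (lookup v c) (lookup v″ c) _ (balanced c) ⟩
      lookup v c + (inc₁ c + incs trace c j)    ≡⟨ cong (lookup v c +_) (sym (incs-cons t trace c j)) ⟩
      lookup v c + incs (t ∷ trace) c (suc j)   ∎
      where open ≤-Reasoning

    balance′ : ∀ c → lookup v′ c + decs (t ∷ trace) c (suc (length trace)) ≡
                     lookup v c + incs (t ∷ trace) c (suc (length trace))
    balance′ c = begin
      lookup v′ c + decs (t ∷ trace) c (suc ℓ)    ≡⟨ cong (lookup v′ c +_) (decs-cons t trace c ℓ) ⟩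
      lookup v′ c + (dec₁ c + decs trace c ℓ)     ≡⟨ x∙yz≈y∙xz (lookup v′ c) (dec₁ c) _ ⟩
      dec₁ c + (lookup v′ c + decs trace c ℓ)     ≡⟨ cong (dec₁ c +_) (balance c) ⟩
      dec₁ c + (lookup v″ c + incs trace c ℓ)     ≡⟨ rebalance _ _ (lookup v c) (lookup v″ c) _ (balanced c) ⟩
      lookup v c + (inc₁ c + incs trace c ℓ)      ≡⟨ cong (lookup v c +_) (sym (incs-cons t trace c ℓ)) ⟩
      lookup v c + incs (t ∷ trace) c (suc ℓ)     ∎
      where open ≡-Reasoning
            ℓ = length trace

  -- The model of a trace: positions 0..m in their natural order, each
  -- carrying its label; B links each position to the next one and each
  -- decrement of c to the increment of c with the same rank among the
  -- increments of c as it has among the decrements of c.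
  module Model (ts : Trace) {qF} (path : Path qI ts qF) (qF-final : F qF ≡ true)
               (enabled : ∀ j c → isDec c (op (labelAt ts (suc j))) ≡ true → decs ts c j < incs ts c j)
               (resets-balanced : ∀ c → R c ≡ true → incs ts c (length ts) ≡ decs ts c (length ts)) where
    m : ℕ
    m = length ts

    lab : ℕ → Label
    lab = labelAt ts

    module Incs (c : Fin nC) = PrefixCount (λ j → isInc c (op (lab j)))
    module Decs (c : Fin nC) = PrefixCount (λ j → isDec c (op (lab j)))

    inc-at : ∀ x {c} → op (lab x) ≡ inc c → isInc c (op (lab x)) ≡ true
    inc-at x {c} e rewrite e = ≟-refl c

    dec-at : ∀ y {c} → op (lab y) ≡ dec c → isDec c (op (lab y)) ≡ true
    dec-at y {c} e rewrite e = ≟-refl c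

    SameRank : Fin nC → ℕ → ℕ → Set
    SameRank c x y = Incs.prefix c x ≡ Decs.prefix c y

    consumesOp : Op nC → Op nC → ℕ → ℕ → Bool
    consumesOp (inc c) (dec c′) x y = does (c ≟ᶠ c′) ∧ does (Incs.prefix c x ℕ.≟ Decs.prefix c y)
    consumesOp _ _ _ _ = false

    consumes : ℕ → ℕ → Bool
    consumes x y = consumesOp (op (lab x)) (op (lab y)) x y

    Consumes : ℕ → ℕ → Fin nC → Set
    Consumes x y c = op (lab x) ≡ inc c × op (lab y) ≡ dec c × SameRank c x y

    consumes⇒ : ∀ x y → consumes x y ≡ true → Σ (Fin nC) (Consumes x y)
    consumes⇒ x y = by-ops (op (lab x)) (op (lab y)) refl refl
      where
      by-ops : ∀ o o′ → op (lab x) ≡ o → op (lab y) ≡ o′ → consumesOp o o′ x y ≡ true →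
               Σ (Fin nC) (Consumes x y)
      by-ops (inc c) (dec c′) ox oy e with c ≟ᶠ c′
      ... | yes refl = c , ox , oy , does-true (Incs.prefix c x ℕ.≟ Decs.prefix c y) e

    consumes⇐ : ∀ x y c → Consumes x y c → consumes x y ≡ true
    consumes⇐ x y c (ox , oy , same) rewrite ox | oy | ≟-refl c =
      dec-true (Incs.prefix c x ℕ.≟ Decs.prefix c y) same

    dec-rank≤ : ∀ j c → op (lab (suc j)) ≡ dec c → Decs.prefix c (suc j) ≤ Incs.prefix c j
    dec-rank≤ j c oy = subst (_≤ Incs.prefix c j) (sym (Decs.prefix-at c j (dec-at (suc j) oy)))
                             (enabled j c (dec-at (suc j) oy))

    consumes⇒< : ∀ x y c → Consumes x y c → x < y
    consumes⇒< x (suc j) c (ox , oy , same) with x ≤? j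
    ... | yes x≤j = s≤s x≤j
    ... | no x≰j = ⊥-elim (<⇒≱ (Incs.prefix-strict c x (≰⇒> x≰j) (inc-at x ox))
                                (subst (_≤ Incs.prefix c j) (sym same) (dec-rank≤ j c oy)))

    consumed-by : ∀ y c → op (lab y) ≡ dec c → Σ ℕ λ x → x < y × consumes x y ≡ true
    consumed-by (suc j) c oy =
      let (x , x≤j , incx , same) = Incs.prefix-attains c j (Decs.prefix c (suc j))
                                      (Decs.prefix-pos c j (dec-at (suc j) oy)) (dec-rank≤ j c oy)
      in x , s≤s x≤j , consumes⇐ x (suc j) c (isInc⇒ c (op (lab x)) incx , oy , same)

    consumer : ∀ x c → x ≤ m → op (lab x) ≡ inc c → R c ≡ true →
               Σ ℕ λ y → y ≤ m × consumes x y ≡ true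
    consumer (suc x′) c x≤m ox r =
      let rank≤ = subst (Incs.prefix c (suc x′) ≤_) (resets-balanced c r) (Incs.prefix-mono c m x≤m)
          (y , y≤m , decy , same) = Decs.prefix-attains c m (Incs.prefix c (suc x′))
                                      (Incs.prefix-pos c x′ (inc-at (suc x′) ox)) rank≤
      in y , y≤m , consumes⇐ (suc x′) y c (ox , isDec⇒ c (op (lab y)) decy , sym same)

    𝔄 : Structure (suc (length δ))
    𝔄 = record
      { n = m
      ; P = λ i a → does (i ≟ᶠ lab (toℕ a))
      ; B = λ a b → does (toℕ b ℕ.≟ suc (toℕ a)) ∨ consumes (toℕ b) (toℕ a)
      ; Lt = λ a b → does (toℕ a <? toℕ b)
      }

    open Structure 𝔄 using (P)
    open Reading 𝔄

    toℕ≤m : ∀ (a : Dom) → toℕ a ≤ m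
    toℕ≤m a = s≤s⁻¹ (Finₚ.toℕ<n a)

    position : ∀ x → x ≤ m → Σ Dom λ a → toℕ a ≡ x
    position x x≤m = fromℕ< (s≤s x≤m) , Finₚ.toℕ-fromℕ< (s≤s x≤m)

    has-label⇒ : ∀ a i → HasLabel a i → i ≡ lab (toℕ a)
    has-label⇒ a i = does-true (i ≟ᶠ lab (toℕ a))

    succ⇒ : ∀ a b → succ a b ≡ true → toℕ b ≡ suc (toℕ a)
    succ⇒ a b e with ∨-elim (∧-elimʳ {does (toℕ a <? toℕ b)} e)
    ... | inj₁ next = does-true (toℕ b ℕ.≟ suc (toℕ a)) next
    ... | inj₂ cons = let (c , b-cons-a) = consumes⇒ (toℕ b) (toℕ a) cons in
                      ⊥-elim (<-asym (does-true (toℕ a <? toℕ b) (∧-elimˡ e))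
                                     (consumes⇒< (toℕ b) (toℕ a) c b-cons-a))

    succ⇐ : ∀ a b → toℕ b ≡ suc (toℕ a) → succ a b ≡ true
    succ⇐ a b e = ∧-intro (dec-true (toℕ a <? toℕ b) (subst (toℕ a <_) (sym e) ≤-refl))
                          (∨-introˡ (dec-true (toℕ b ℕ.≟ suc (toℕ a)) e))

    match⇒ : ∀ a b → match a b ≡ true → consumes (toℕ a) (toℕ b) ≡ true
    match⇒ a b e with ∨-elim (∧-elimʳ {does (toℕ a <? toℕ b)} e)
    ... | inj₂ cons = cons
    ... | inj₁ next = ⊥-elim (<-asym (does-true (toℕ a <? toℕ b) (∧-elimˡ e))
                        (subst (toℕ b <_) (sym (does-true (toℕ a ℕ.≟ suc (toℕ b)) next)) ≤-refl))

    match⇐ : ∀ a b → consumes (toℕ a) (toℕ b) ≡ true → match a b ≡ true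
    match⇐ a b cons = let (c , a-cons-b) = consumes⇒ (toℕ a) (toℕ b) cons in
      ∧-intro (dec-true (toℕ a <? toℕ b) (consumes⇒< (toℕ a) (toℕ b) c a-cons-b))
              (∨-introʳ {does (toℕ a ℕ.≟ suc (toℕ b))} cons)

    start-position : ∀ x → x ≤ m → lab x ≡ Fin.zero → x ≡ 0
    start-position zero _ _ = refl
    start-position (suc j) j<m e with labelAt-inside ts j j<m
    ... | t , et with () ← trans (sym e) et

    module Proofs where
      labelled-all : ∀ a → Σ Label (HasLabel a)
      labelled-all a = lab (toℕ a) , ≟-refl (lab (toℕ a))

      start-exists : Σ Dom λ a → HasLabel a Fin.zero
      start-exists = Fin.zero , ≟-refl {suc (length δ)} Fin.zero

      start-unique : ∀ a a′ → HasLabel a Fin.zero → HasLabel a′ Fin.zero → a ≡ a′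
      start-unique a a′ p p′ = Finₚ.toℕ-injective (trans (at-zero a p) (sym (at-zero a′ p′)))
        where at-zero : ∀ a → HasLabel a Fin.zero → toℕ a ≡ 0
              at-zero a p = start-position (toℕ a) (toℕ≤m a) (sym (has-label⇒ a Fin.zero p))

      has-predecessor : ∀ a → P Fin.zero a ≡ false → Σ Dom λ b → succ b a ≡ true
      has-predecessor a ¬start = by-position (toℕ a) refl
        where
        by-position : ∀ x → toℕ a ≡ x → Σ Dom λ b → succ b a ≡ true
        by-position zero e =
          ⊥-elim (true≢false (subst (λ x → does (Fin.zero ≟ᶠ lab x) ≡ true) (sym e) (≟-refl (lab 0))) ¬start)
        by-position (suc j) e =
          let (b , b≡j) = position j (≤-trans (n≤1+n j) (subst (_≤ m) e (toℕ≤m a)))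
          in b , succ⇐ b a (trans e (cong suc (sym b≡j)))

      succ-follows : ∀ a b → succ a b ≡ true → ∀ i j → HasLabel a i → HasLabel b j → canFollow i j ≡ true
      succ-follows a b s i j pi pj =
        subst₂ (λ i j → canFollow i j ≡ true) (sym (has-label⇒ a i pi)) (sym (has-label⇒ b j pj))
          (subst (λ y → canFollow (lab (toℕ a)) (lab y) ≡ true) (sym (succ⇒ a b s))
            (path-follows₀ ts path (toℕ a) (subst (_≤ m) (succ⇒ a b s) (toℕ≤m b))))

      succ-unique : ∀ a b b′ → succ a b ≡ true → succ a b′ ≡ true → b ≡ b′
      succ-unique a b b′ s s′ = Finₚ.toℕ-injective (trans (succ⇒ a b s) (sym (succ⇒ a b′ s′)))

      last-final : ∀ a → (∀ b → succ a b ≡ false) → ∀ i → HasLabel a i → final i ≡ true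
      last-final a none i pi with toℕ a ℕ.≟ m
      ... | yes a≡m = subst (λ i → final i ≡ true) (sym (trans (has-label⇒ a i pi) (cong lab a≡m)))
                            (path-final ts path qF-final)
      ... | no a≢m = let (b , b≡) = position (suc (toℕ a)) (≤∧≢⇒< (toℕ≤m a) a≢m) in
                     ⊥-elim (true≢false (succ⇐ a b b≡) (none b))

      dec-matched : ∀ a i → HasLabel a i → decrements (op i) ≡ true → Σ Dom λ b → match b a ≡ true
      dec-matched a i pi d =
        let (c , opi) = decrements⇒ (op i) d
            (x , x<a , cons) = consumed-by (toℕ a) c (trans (cong op (sym (has-label⇒ a i pi))) opi)
            (b , b≡x) = position x (≤-trans (n≤1+n x) (≤-trans x<a (toℕ≤m a)))
        in b , match⇐ b a (subst (λ x → consumes x (toℕ a) ≡ true) (sym b≡x) cons)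

      dec-match-unique : ∀ a b b′ → match b a ≡ true → match b′ a ≡ true → b ≡ b′
      dec-match-unique a b b′ m m′
        with c , ob , oa , e ← consumes⇒ (toℕ b) (toℕ a) (match⇒ b a m)
           | c′ , ob′ , oa′ , e′ ← consumes⇒ (toℕ b′) (toℕ a) (match⇒ b′ a m′)
        with refl ← trans (sym oa) oa′ = Finₚ.toℕ-injective
          (Incs.prefix-injective c (toℕ b) (toℕ b′) (inc-at (toℕ b) ob) (inc-at (toℕ b′) ob′)
                                 (trans e (sym e′)))

      match-matchable : ∀ a b → match a b ≡ true → ∀ i j → HasLabel a i → HasLabel b j →
                        matchable (op i) (op j) ≡ true
      match-matchable a b m i j pi pj with c , oa , ob , _ ← consumes⇒ (toℕ a) (toℕ b) (match⇒ a b m)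
        rewrite has-label⇒ a i pi | has-label⇒ b j pj | oa | ob = ≟-refl c

      inc-match-unique : ∀ a b b′ → match a b ≡ true → match a b′ ≡ true → b ≡ b′
      inc-match-unique a b b′ m m′
        with c , oa , ob , e ← consumes⇒ (toℕ a) (toℕ b) (match⇒ a b m)
           | c′ , oa′ , ob′ , e′ ← consumes⇒ (toℕ a) (toℕ b′) (match⇒ a b′ m′)
        with refl ← trans (sym oa) oa′ = Finₚ.toℕ-injective
          (Decs.prefix-injective c (toℕ b) (toℕ b′) (dec-at (toℕ b) ob) (dec-at (toℕ b′) ob′)
                                 (trans (sym e) e′))

      reset-matched : ∀ a i → HasLabel a i → resetInc (op i) ≡ true → Σ Dom λ b → match a b ≡ true
      reset-matched a i pi r =
        let (c , opi , rc) = resetInc⇒ (op i) r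
            opa = trans (cong op (sym (has-label⇒ a i pi))) opi
            (y , y≤m , cons) = consumer (toℕ a) c (toℕ≤m a) opa rc
            (b , b≡y) = position y y≤m
        in b , match⇐ a b (subst (λ y → consumes (toℕ a) y ≡ true) (sym b≡y) cons)

    axioms : Axioms
    axioms = record { Proofs }

  model : HasAcceptingRun M → FinSat sentenceOf
  model (qF , nF , run , qF-final , resets) = 𝔐.𝔄 , fin-order , Reading.axioms-complete 𝔐.𝔄 𝔐.axioms
    where
    open RunTrace (runTrace run)
    enabled₀ : ∀ j c → isDec c (op (labelAt trace (suc j))) ≡ true → decs trace c j < incs trace c j
    enabled₀ j c d = subst (λ k → decs trace c j < k + incs trace c j) (lookup-replicate c 0) (enabled j c d)

    resets-balanced : ∀ c → R c ≡ true → incs trace c (length trace) ≡ decs trace c (length trace)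
    resets-balanced c r = sym (trans (cong (_+ decs trace c (length trace)) (sym (resets c r)))
      (trans (balance c) (cong (_+ incs trace c (length trace)) (lookup-replicate c 0))))

    module 𝔐 = Model trace path qF-final enabled₀ resets-balanced

theorem5p4 : Σ (MCA → Sentence) λ f →
               ∀ M → (HasAcceptingRun M → FinSat (f M)) × (FinSat (f M) → HasAcceptingRun M)
theorem5p4 = Reduction.sentenceOf , λ M → Completeness.model M , run-of-model M
  where
  run-of-model : ∀ M → FinSat (Reduction.sentenceOf M) → HasAcceptingRun M
  run-of-model M (𝔄 , slo , sat) = Soundness.accepting M 𝔄 slo (Reduction.Reading.axioms-sound M 𝔄 sat)
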